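{- For all $\lambda\mu$-terms $M,N$, every variable $x$ and all names $\alpha,\beta$: (1) $\mathcal T(M\{\alpha/\beta\})=\{t\{\alpha/\beta\}\mid t\in\mathcal T(M)\}$; (2) $\mathcal T(M\{N/x\})=\bigcup_{t\in\mathcal T(M)}\bigcup_{[u_1,\dots,u_k]\text{ bag of elements of }\mathcal T(N)}t\langle[u_1,\dots,u_k]/x\rangle$; (3) $\mathcal T((M)_\alpha N)=\bigcup_{t\in\mathcal T(M)}\bigcup_{[u_1,\dots,u_k]\text{ bag of elements of }\mathcal T(N)}\langle t\rangle_\alpha[u_1,\dots,u_k]$. Here sums are regarded as sets.
   Context: Fix disjoint countably infinite sets of variables and names. $\lambda\mu$-terms: $M::=x\mid\lambda x.M\mid MM\mid\mu\alpha.{}_\beta|M|$, up to renaming of bound variables and names. - $M\{N/x\}$ is capture-avoiding substitution. - $\{\alpha/\beta\}$ renames all free occurrences of the name $\beta$ into $\alpha$, on both $\lambda\mu$-terms and resource terms. Named application $(M)_\alpha N$: - $(x)_\alpha N=x$, $(\lambda x.M)_\alpha N=\lambda x.(M)_\alpha N$, $(MP)_\alpha N=((M)_\alpha N)((P)_\alpha N)$. - $(\mu\beta.{}_\gamma|M|)_\alpha N=\mu\beta.{}_\gamma|(M)_\alpha N|$ for $\gamma\ne\alpha$, and $(\mu\beta.{}_\alpha|M|)_\alpha N=\mu\beta.{}_\alpha|((M)_\alpha N)N|$. Resource terms and sums. - Resource terms: $t::=x\mid\lambda x.t\mid t[t_1,\dots,t_n]\mid\mu\alpha.{}_\beta|t|$,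 with bags finite multisets; $1$ is the empty bag. - Sums are finite sets with idempotent $+$ and empty sum $0$; constructors extend multilinearly, and $0$ annihilates. - A weak composition (w.c.) of a bag $B$ is a tuple of possibly empty bags whose union is $B$. Linear substitution $t\langle B/x\rangle$: - $x\langle[v]/x\rangle=v$, and $x\langle B/x\rangle=0$ otherwise. - For $y\ne x$: $y\langle1/x\rangle=y$, and $y\langle B/x\rangle=0$ if $B\ne1$. - It commutes with $\lambda y$ and with $\mu\alpha.{}_\beta|\cdot|$. - $(t[v_1..v_n])\langle B/x\rangle=\sum_{(B_0..B_n)\text{ w.c. of }B}t\langle B_0/x\rangle[v_i\langle B_i/x\rangle]_i$. Linear named application $\langle t\rangle_\alpha B$: - $\langle x\rangle_\alpha1=x$, and $\langle x\rangle_\alpha B=0$ if $B\ne1$. - It commutes with $\lambda y$, and $\langle\mu\gamma.{}_\eta|t|\rangle_\alpha B=\mu\gamma.\langle{}_\eta|t|\rangle_\alpha B$. - $\langle{}_\eta|t|\rangle_\alpha B={}_\eta|\langle t\rangle_\alpha B|$ ($\eta\ne\alpha$), and $\langle{}_\alpha|t|\rangle_\alpha B=\sum_{(B_1,B_2)\text{ w.c.}}{}_\alpha|(\langle t\rangle_\alpha B_1)B_2|$. - $\langle t[v_1..v_n]\rangle_\alpha B=\sum_{(B_0..B_n)}(\langle t\rangle_\alpha B_0)[\langle v_i\rangle_\alpha B_i]_i$. Taylor expansion. - $\mathcal T(x)=\{x\}$, $\mathcal T(\lambda x.M)=\{\lambda x.t\mid t\in\mathcal T(M)\}$, $\mathcal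 T(\mu\alpha.{}_\beta|M|)=\{\mu\alpha.{}_\beta|t|\mid t\in\mathcal T(M)\}$. - $\mathcal T(MN)=\{t[u_1..u_n]\mid t\in\mathcal T(M),n\ge0,u_i\in\mathcal T(N)\}$. -}

module Defs where

open import Data.Nat using (ℕ; zero; suc; _≡ᵇ_)
open import Data.Bool using (if_then_else_)
open import Data.List using (List; []; _∷_; _++_; concat)
open import Data.List.Relation.Unary.All using (All)
open import Data.List.Relation.Binary.Permutation.Homogeneous using (Permutation)
open import Data.Product using (_×_; ∃-syntax)
open import Relation.Binary.PropositionalEquality using (_≡_; _≢_)

-- Both variables and names are de Bruijn indices (ℕ), so
-- terms are automatically taken up to renaming of bound variables/names.
-- λ binds variable index 0, μ binds name index 0.  Free variables/names
-- are the indices reaching outside all binders.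

data Term : Set where
  var : ℕ → Term
  lam : Term → Term
  app : Term → Term → Term
  mu  : ℕ → Term → Term        -- mu β M  =  μα.β|M|   (α = name index 0)

ext : (ℕ → ℕ) → ℕ → ℕ
ext ρ zero    = zero
ext ρ (suc n) = suc (ρ n)

renV : (ℕ → ℕ) → Term → Term
renV ρ (var x)   = var (ρ x)
renV ρ (lam M)   = lam (renV (ext ρ) M)
renV ρ (app M N) = app (renV ρ M) (renV ρ N)
renV ρ (mu β M)  = mu β (renV ρ M)

-- renaming of names (the name in  mu β M  lives in the extended scope)
renN : (ℕ → ℕ) → Term → Term
renN ρ (var x)   = var x
renN ρ (lam M)   = lam (renN ρ M)
renN ρ (app M N) = app (renN ρ M) (renN ρ N)
renN ρ (mu β M)  = mu (ext ρ β) (renN (ext ρ) M)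

exts : (ℕ → Term) → ℕ → Term
exts σ zero    = var zero
exts σ (suc n) = renV suc (σ n)

subst : (ℕ → Term) → Term → Term
subst σ (var x)   = σ x
subst σ (lam M)   = lam (subst (exts σ) M)
subst σ (app M N) = app (subst σ M) (subst σ N)
subst σ (mu β M)  = mu β (subst (λ n → renN suc (σ n)) M)

_[_/_] : Term → Term → ℕ → Term
M [ N / x ] = subst (λ y → if y ≡ᵇ x then N else var y) M

_⟪_/_⟫ : Term → ℕ → ℕ → Term
M ⟪ α / β ⟫ = renN (λ γ → if γ ≡ᵇ β then α else γ) M

-- named application  napp α N M  =  (M)_α N
napp : ℕ → Term → Term → Term
napp α N (var x)   = var x
napp α N (lam M)   = lam (napp α (renV suc N) M)
napp α N (app M P) = app (napp α N M) (napp α N P)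
napp α N (mu γ M)  =
  mu γ (if γ ≡ᵇ suc α
        then app (napp (suc α) (renN suc N) M) (renN suc N)
        else napp (suc α) (renN suc N) M)

-- Resource terms; bags are lists, considered up to permutation (see _≈_)

data RTerm : Set where
  rvar : ℕ → RTerm
  rlam : RTerm → RTerm
  rapp : RTerm → List RTerm → RTerm
  rmu  : ℕ → RTerm → RTerm

Bag : Set
Bag = List RTerm

data _≈_ : RTerm → RTerm → Set where
  rvar : ∀ {x} → rvar x ≈ rvar x
  rlam : ∀ {t t'} → t ≈ t' → rlam t ≈ rlam t'
  rapp : ∀ {t t' B B'} → t ≈ t' → Permutation _≈_ B B' → rapp t B ≈ rapp t' B'
  rmu  : ∀ {β t t'} → t ≈ t' → rmu β t ≈ rmu β t'

_≈ᴮ_ : Bag → Bag → Set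
B ≈ᴮ B' = Permutation _≈_ B B'

mutual
  rrenV : (ℕ → ℕ) → RTerm → RTerm
  rrenV ρ (rvar x)   = rvar (ρ x)
  rrenV ρ (rlam t)   = rlam (rrenV (ext ρ) t)
  rrenV ρ (rapp t B) = rapp (rrenV ρ t) (rrenVs ρ B)
  rrenV ρ (rmu β t)  = rmu β (rrenV ρ t)

  rrenVs : (ℕ → ℕ) → Bag → Bag
  rrenVs ρ []      = []
  rrenVs ρ (u ∷ B) = rrenV ρ u ∷ rrenVs ρ B

mutual
  rrenN : (ℕ → ℕ) → RTerm → RTerm
  rrenN ρ (rvar x)   = rvar x
  rrenN ρ (rlam t)   = rlam (rrenN ρ t)
  rrenN ρ (rapp t B) = rapp (rrenN ρ t) (rrenNs ρ B)
  rrenN ρ (rmu β t)  = rmu (ext ρ β) (rrenN (ext ρ) t)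

  rrenNs : (ℕ → ℕ) → Bag → Bag
  rrenNs ρ []      = []
  rrenNs ρ (u ∷ B) = rrenN ρ u ∷ rrenNs ρ B

_⟪_/_⟫ʳ : RTerm → ℕ → ℕ → RTerm
t ⟪ α / β ⟫ʳ = rrenN (λ γ → if γ ≡ᵇ β then α else γ) t

-- Sums regarded as sets: a sum is a predicate on resource terms.

RSet : Set₁
RSet = RTerm → Set

-- Linear substitution.  LSub x t B s  means  s ∈ t⟨B/x⟩.
-- A weak composition (B₀,…,Bₙ) of B is a tuple of bags whose union is B:
-- concat of the components is a permutation (up to ≈) of B.
mutual
  data LSub : ℕ → RTerm → Bag → RTerm → Set where
    var-hit  : ∀ {x v} → LSub x (rvar x) (v ∷ []) v
    var-miss : ∀ {x y} → y ≢ x → LSub x (rvar y) [] (rvar y)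
    lam      : ∀ {x t B s} → LSub (suc x) t (rrenVs suc B) s →
               LSub x (rlam t) B (rlam s)
    mu       : ∀ {x β t B s} → LSub x t (rrenNs suc B) s →
               LSub x (rmu β t) B (rmu β s)
    app      : ∀ {x t vs B B₀ Bs s₀ ss} →
               (B₀ ++ concat Bs) ≈ᴮ B →
               LSub x t B₀ s₀ → LSubs x vs Bs ss →
               LSub x (rapp t vs) B (rapp s₀ ss)

  data LSubs : ℕ → Bag → List Bag → Bag → Set where
    []  : ∀ {x} → LSubs x [] [] []
    _∷_ : ∀ {x v vs B Bs s ss} → LSub x v B s → LSubs x vs Bs ss →
          LSubs x (v ∷ vs) (B ∷ Bs) (s ∷ ss)

-- Linear named application.  NApp α t B s  means  s ∈ ⟨t⟩_α B.
mutual
  data NApp : ℕ → RTerm → Bag → RTerm → Set where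
    var      : ∀ {α x} → NApp α (rvar x) [] (rvar x)
    lam      : ∀ {α t B s} → NApp α t (rrenVs suc B) s →
               NApp α (rlam t) B (rlam s)
    -- ⟨μγ.η|t|⟩_α B with η ≠ α  (inside the binder α becomes suc α)
    mu-other : ∀ {α η t B s} → η ≢ suc α →
               NApp (suc α) t (rrenNs suc B) s →
               NApp α (rmu η t) B (rmu η s)
    -- ⟨μγ.α|t|⟩_α B = Σ_{(B₁,B₂) w.c.} μγ.α|(⟨t⟩_α B₁) B₂|
    mu-same  : ∀ {α t B B₁ B₂ s} →
               (B₁ ++ B₂) ≈ᴮ rrenNs suc B →
               NApp (suc α) t B₁ s →
               NApp α (rmu (suc α) t) B (rmu (suc α) (rapp s B₂))
    app      : ∀ {α t vs B B₀ Bs s₀ ss} →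
               (B₀ ++ concat Bs) ≈ᴮ B →
               NApp α t B₀ s₀ → NApps α vs Bs ss →
               NApp α (rapp t vs) B (rapp s₀ ss)

  data NApps : ℕ → Bag → List Bag → Bag → Set where
    []  : ∀ {α} → NApps α [] [] []
    _∷_ : ∀ {α v vs B Bs s ss} → NApp α v B s → NApps α vs Bs ss →
          NApps α (v ∷ vs) (B ∷ Bs) (s ∷ ss)

-- Taylor expansion, as a set (predicate) of resource terms

data 𝒯 : Term → RTerm → Set where
  var : ∀ {x} → 𝒯 (var x) (rvar x)
  lam : ∀ {M t} → 𝒯 M t → 𝒯 (lam M) (rlam t)
  mu  : ∀ {β M t} → 𝒯 M t → 𝒯 (mu β M) (rmu β t)
  app : ∀ {M N t us} → 𝒯 M t → All (𝒯 N) us → 𝒯 (app M N) (rapp t us)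

_∈≈_ : RTerm → RSet → Set
s ∈≈ S = ∃[ s' ] (S s' × s ≈ s')

_≐_ : RSet → RSet → Set
S ≐ S' = ∀ s → (s ∈≈ S → s ∈≈ S') × (s ∈≈ S' → s ∈≈ S)

-- Each of the three operations on λμ-terms is mirrored constructor by
-- constructor by its resource counterpart, and 𝒯 commutes with every
-- constructor, so both inclusions go by induction on M.  The only real
-- content sits at applications (and at μ-binders in front of the applied
-- name): a bag of elements of 𝒯 N splits along any weak composition into
-- bags of elements of 𝒯 N, and conversely the union of such bags is again
-- one.  Since 𝒯 M is closed under ≈, it does not matter that a weak
-- composition only recovers the bag up to permutation.  Finally, 𝒯
-- commutes with renamings, which accounts for the de Bruijn shifts of N
-- under binders.
module Submission where

open import Defs
open import Data.Nat using (ℕ; zero; suc; _≡ᵇ_; _≟_)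
open import Data.Nat.Properties using (≡ᵇ⇒≡; ≡⇒≡ᵇ)
open import Data.Bool using (true; false; if_then_else_)
open import Data.Bool.Properties using (T-≡; ¬-not)
open import Data.List using ([]; _∷_; _++_; concat)
open import Data.List.Relation.Unary.All using (All; []; _∷_)
open import Data.List.Relation.Unary.All.Properties using (++⁺; ++⁻; concat⁺; concat⁻)
open import Data.List.Relation.Binary.Pointwise using (Pointwise; []; _∷_; All-resp-Pointwise)
open import Data.List.Relation.Binary.Pointwise.Properties using (symmetric)
open import Data.List.Relation.Binary.Permutation.Homogeneous using (Permutation; refl; prep; swap; trans)
open import Data.Product using (_×_; ∃-syntax; _,_; map₂)
open import Function using (id; _∘_)
open import Function.Bundles using (Equivalence)
open import Relation.Binary.PropositionalEquality using (_≡_; _≢_; refl; sym; cong)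
  renaming (subst to transport)
open import Relation.Nullary using (yes; no)
open import Relation.Unary using (_⊆_)

≡ᵇ-refl : ∀ n → (n ≡ᵇ n) ≡ true
≡ᵇ-refl n = Equivalence.to T-≡ (≡⇒≡ᵇ n n refl)

≢⇒≡ᵇ-false : ∀ {m n} → m ≢ n → (m ≡ᵇ n) ≡ false
≢⇒≡ᵇ-false {m} {n} m≢n = ¬-not (m≢n ∘ ≡ᵇ⇒≡ m n ∘ Equivalence.from T-≡)

All-resp-Permutation⁻ : ∀ {A : Set} {R : A → A → Set} {P : A → Set} →
  (∀ {x y} → R x y → P y → P x) →
  ∀ {xs ys} → Permutation R xs ys → All P ys → All P xs
All-resp-Permutation⁻ resp (refl xs∼ys)        = All-resp-Pointwise resp (symmetric id xs∼ys)
All-resp-Permutation⁻ resp (prep x∼y p)        (py ∷ pys) = resp x∼y py ∷ All-resp-Permutation⁻ resp p pys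
All-resp-Permutation⁻ resp (swap x∼x′ y∼y′ p) (px′ ∷ py′ ∷ pys) =
  resp x∼x′ py′ ∷ resp y∼y′ px′ ∷ All-resp-Permutation⁻ resp p pys
All-resp-Permutation⁻ resp (trans p q)         pzs =
  All-resp-Permutation⁻ resp p (All-resp-Permutation⁻ resp q pzs)

mutual
  ≈-refl : ∀ t → t ≈ t
  ≈-refl (rvar x)   = rvar
  ≈-refl (rlam t)   = rlam (≈-refl t)
  ≈-refl (rapp t B) = rapp (≈-refl t) (refl (≈-pointwise-refl B))
  ≈-refl (rmu β t)  = rmu (≈-refl t)

  ≈-pointwise-refl : ∀ B → Pointwise _≈_ B B
  ≈-pointwise-refl []      = []
  ≈-pointwise-refl (u ∷ B) = ≈-refl u ∷ ≈-pointwise-refl B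

≈ᴮ-refl : ∀ B → B ≈ᴮ B
≈ᴮ-refl B = refl (≈-pointwise-refl B)

𝒯-resp-≈ : ∀ M {s s′} → s ≈ s′ → 𝒯 M s′ → 𝒯 M s
𝒯-resp-≈ (var _)   rvar       var         = var
𝒯-resp-≈ (lam M)   (rlam e)   (lam d)     = lam (𝒯-resp-≈ M e d)
𝒯-resp-≈ (app M N) (rapp e p) (app d ds)  =
  app (𝒯-resp-≈ M e d) (All-resp-Permutation⁻ (𝒯-resp-≈ N) p ds)
𝒯-resp-≈ (mu β M)  (rmu e)    (mu d)      = mu (𝒯-resp-≈ M e d)

All-weakComposition⁺ : ∀ {P : RTerm → Set} {B₀ Bs} →
  All P B₀ → All (All P) Bs → All P (B₀ ++ concat Bs)
All-weakComposition⁺ ps₀ pss = ++⁺ ps₀ (concat⁺ pss)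

module _ {N : Term} where

  All-𝒯-++⁻ : ∀ {B B₁ B₂} → (B₁ ++ B₂) ≈ᴮ B → All (𝒯 N) B → All (𝒯 N) B₁ × All (𝒯 N) B₂
  All-𝒯-++⁻ {B₁ = B₁} p ds = ++⁻ B₁ (All-resp-Permutation⁻ (𝒯-resp-≈ N) p ds)

  All-𝒯-weakComposition⁻ : ∀ {B B₀ Bs} → (B₀ ++ concat Bs) ≈ᴮ B → All (𝒯 N) B →
                            All (𝒯 N) B₀ × All (All (𝒯 N)) Bs
  All-𝒯-weakComposition⁻ p ds = map₂ concat⁻ (All-𝒯-++⁻ p ds)

mutual
  𝒯-renV⁺ : ∀ ρ N {u} → 𝒯 N u → 𝒯 (renV ρ N) (rrenV ρ u)
  𝒯-renV⁺ ρ (var x)   var        = var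
  𝒯-renV⁺ ρ (lam N)   (lam d)    = lam (𝒯-renV⁺ (ext ρ) N d)
  𝒯-renV⁺ ρ (app M N) (app d ds) = app (𝒯-renV⁺ ρ M d) (All-𝒯-renV⁺ ρ N ds)
  𝒯-renV⁺ ρ (mu β N)  (mu d)     = mu (𝒯-renV⁺ ρ N d)

  All-𝒯-renV⁺ : ∀ ρ N {B} → All (𝒯 N) B → All (𝒯 (renV ρ N)) (rrenVs ρ B)
  All-𝒯-renV⁺ ρ N []       = []
  All-𝒯-renV⁺ ρ N (d ∷ ds) = 𝒯-renV⁺ ρ N d ∷ All-𝒯-renV⁺ ρ N ds

mutual
  𝒯-renV⁻ : ∀ ρ N {u} → 𝒯 (renV ρ N) u → ∃[ u′ ] (𝒯 N u′ × u ≡ rrenV ρ u′)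
  𝒯-renV⁻ ρ (var x) var = rvar x , var , refl
  𝒯-renV⁻ ρ (lam N) (lam d) with 𝒯-renV⁻ (ext ρ) N d
  ... | u , d′ , refl = rlam u , lam d′ , refl
  𝒯-renV⁻ ρ (app M N) (app d ds) with 𝒯-renV⁻ ρ M d | All-𝒯-renV⁻ ρ N ds
  ... | t , d′ , refl | B , ds′ , refl = rapp t B , app d′ ds′ , refl
  𝒯-renV⁻ ρ (mu β N) (mu d) with 𝒯-renV⁻ ρ N d
  ... | u , d′ , refl = rmu β u , mu d′ , refl

  All-𝒯-renV⁻ : ∀ ρ N {B} → All (𝒯 (renV ρ N)) B → ∃[ B′ ] (All (𝒯 N) B′ × B ≡ rrenVs ρ B′)
  All-𝒯-renV⁻ ρ N [] = [] , [] , refl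
  All-𝒯-renV⁻ ρ N (d ∷ ds) with 𝒯-renV⁻ ρ N d | All-𝒯-renV⁻ ρ N ds
  ... | u , d′ , refl | B , ds′ , refl = u ∷ B , d′ ∷ ds′ , refl

mutual
  𝒯-renN⁺ : ∀ ρ N {u} → 𝒯 N u → 𝒯 (renN ρ N) (rrenN ρ u)
  𝒯-renN⁺ ρ (var x)   var        = var
  𝒯-renN⁺ ρ (lam N)   (lam d)    = lam (𝒯-renN⁺ ρ N d)
  𝒯-renN⁺ ρ (app M N) (app d ds) = app (𝒯-renN⁺ ρ M d) (All-𝒯-renN⁺ ρ N ds)
  𝒯-renN⁺ ρ (mu β N)  (mu d)     = mu (𝒯-renN⁺ (ext ρ) N d)

  All-𝒯-renN⁺ : ∀ ρ N {B} → All (𝒯 N) B → All (𝒯 (renN ρ N)) (rrenNs ρ B)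
  All-𝒯-renN⁺ ρ N []       = []
  All-𝒯-renN⁺ ρ N (d ∷ ds) = 𝒯-renN⁺ ρ N d ∷ All-𝒯-renN⁺ ρ N ds

mutual
  𝒯-renN⁻ : ∀ ρ N {u} → 𝒯 (renN ρ N) u → ∃[ u′ ] (𝒯 N u′ × u ≡ rrenN ρ u′)
  𝒯-renN⁻ ρ (var x) var = rvar x , var , refl
  𝒯-renN⁻ ρ (lam N) (lam d) with 𝒯-renN⁻ ρ N d
  ... | u , d′ , refl = rlam u , lam d′ , refl
  𝒯-renN⁻ ρ (app M N) (app d ds) with 𝒯-renN⁻ ρ M d | All-𝒯-renN⁻ ρ N ds
  ... | t , d′ , refl | B , ds′ , refl = rapp t B , app d′ ds′ , refl
  𝒯-renN⁻ ρ (mu β N) (mu d) with 𝒯-renN⁻ (ext ρ) N d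
  ... | u , d′ , refl = rmu β u , mu d′ , refl

  All-𝒯-renN⁻ : ∀ ρ N {B} → All (𝒯 (renN ρ N)) B → ∃[ B′ ] (All (𝒯 N) B′ × B ≡ rrenNs ρ B′)
  All-𝒯-renN⁻ ρ N [] = [] , [] , refl
  All-𝒯-renN⁻ ρ N (d ∷ ds) with 𝒯-renN⁻ ρ N d | All-𝒯-renN⁻ ρ N ds
  ... | u , d′ , refl | B , ds′ , refl = u ∷ B , d′ ∷ ds′ , refl

-- M [ N / x ] is not stable under going below binders, so the induction runs over
-- every σ that acts as the single substitution of N for x.
SingleSubst : (ℕ → Term) → ℕ → Term → Set
SingleSubst σ x N = (σ x ≡ N) × (∀ y → y ≢ x → σ y ≡ var y)

SingleSubst-exts : ∀ {σ x N} → SingleSubst σ x N → SingleSubst (exts σ) (suc x) (renV suc N)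
SingleSubst-exts (σx≡N , σ-id) = cong (renV suc) σx≡N , λ
  { zero    _       → refl
  ; (suc y) y+1≢x+1 → cong (renV suc) (σ-id y (y+1≢x+1 ∘ cong suc)) }

SingleSubst-renN : ∀ {σ x N} → SingleSubst σ x N → SingleSubst (renN suc ∘ σ) x (renN suc N)
SingleSubst-renN (σx≡N , σ-id) = cong (renN suc) σx≡N , λ y y≢x → cong (renN suc) (σ-id y y≢x)

SingleSubst-[/] : ∀ N x → SingleSubst (λ y → if y ≡ᵇ x then N else var y) x N
SingleSubst-[/] N x = cong (if_then N else var x) (≡ᵇ-refl x) ,
                      λ y y≢x → cong (if_then N else var y) (≢⇒≡ᵇ-false y≢x)

⋃LSub : ℕ → Term → Term → RTerm → Set
⋃LSub x M N s = ∃[ t ] ∃[ B ] (𝒯 M t × All (𝒯 N) B × LSub x t B s)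

mutual
  𝒯-subst⊆⋃LSub : ∀ M {σ x N} → SingleSubst σ x N → 𝒯 (subst σ M) ⊆ ⋃LSub x M N
  𝒯-subst⊆⋃LSub (var y) {σ} {x} {N} (σx≡N , σ-id) {s} d with y ≟ x
  ... | yes refl = rvar y , s ∷ [] , var , transport (λ P → 𝒯 P s) σx≡N d ∷ [] , var-hit
  ... | no y≢x with transport (λ P → 𝒯 P s) (σ-id y y≢x) d
  ...   | var = rvar y , [] , var , [] , var-miss y≢x
  𝒯-subst⊆⋃LSub (lam M) {N = N} single (lam d) with 𝒯-subst⊆⋃LSub M (SingleSubst-exts single) d
  ... | t , _ , dt , ds , ls with All-𝒯-renV⁻ suc N ds
  ...   | B , ds′ , refl = rlam t , B , lam dt , ds′ , lam ls
  𝒯-subst⊆⋃LSub (mu β M) {N = N} single (mu d) with 𝒯-subst⊆⋃LSub M (SingleSubst-renN single) d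
  ... | t , _ , dt , ds , ls with All-𝒯-renN⁻ suc N ds
  ...   | B , ds′ , refl = rmu β t , B , mu dt , ds′ , mu ls
  𝒯-subst⊆⋃LSub (app M P) single (app d ds)
    with 𝒯-subst⊆⋃LSub M single d | All-𝒯-subst⊆⋃LSubs P single ds
  ... | t , B₀ , dt , ds₀ , ls | vs , Bs , dvs , dss , lss =
    rapp t vs , B₀ ++ concat Bs , app dt dvs , All-weakComposition⁺ ds₀ dss , app (≈ᴮ-refl _) ls lss

  All-𝒯-subst⊆⋃LSubs : ∀ P {σ x N us} → SingleSubst σ x N → All (𝒯 (subst σ P)) us →
    ∃[ vs ] ∃[ Bs ] (All (𝒯 P) vs × All (All (𝒯 N)) Bs × LSubs x vs Bs us)
  All-𝒯-subst⊆⋃LSubs P single [] = [] , [] , [] , [] , []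
  All-𝒯-subst⊆⋃LSubs P single (d ∷ ds)
    with 𝒯-subst⊆⋃LSub P single d | All-𝒯-subst⊆⋃LSubs P single ds
  ... | t , B , dt , dB , ls | vs , Bs , dvs , dss , lss =
    t ∷ vs , B ∷ Bs , dt ∷ dvs , dB ∷ dss , ls ∷ lss

mutual
  ⋃LSub⊆𝒯-subst : ∀ M {σ x N} → SingleSubst σ x N → ⋃LSub x M N ⊆ 𝒯 (subst σ M)
  ⋃LSub⊆𝒯-subst (var y) (σx≡N , _) (_ , _ , var , d ∷ [] , var-hit) =
    transport (λ P → 𝒯 P _) (sym σx≡N) d
  ⋃LSub⊆𝒯-subst (var y) (_ , σ-id) (_ , _ , var , [] , var-miss y≢x) =
    transport (λ P → 𝒯 P _) (sym (σ-id y y≢x)) var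
  ⋃LSub⊆𝒯-subst (lam M) {N = N} single (_ , _ , lam dt , ds , lam ls) =
    lam (⋃LSub⊆𝒯-subst M (SingleSubst-exts single) (_ , _ , dt , All-𝒯-renV⁺ suc N ds , ls))
  ⋃LSub⊆𝒯-subst (mu β M) {N = N} single (_ , _ , mu dt , ds , mu ls) =
    mu (⋃LSub⊆𝒯-subst M (SingleSubst-renN single) (_ , _ , dt , All-𝒯-renN⁺ suc N ds , ls))
  ⋃LSub⊆𝒯-subst (app M P) single (_ , _ , app dt dvs , ds , app p ls lss)
    with All-𝒯-weakComposition⁻ p ds
  ... | ds₀ , dss =
    app (⋃LSub⊆𝒯-subst M single (_ , _ , dt , ds₀ , ls)) (⋃LSubs⊆All-𝒯-subst P single dvs dss lss)

  ⋃LSubs⊆All-𝒯-subst : ∀ P {σ x N vs Bs ss} → SingleSubst σ x N →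
    All (𝒯 P) vs → All (All (𝒯 N)) Bs → LSubs x vs Bs ss → All (𝒯 (subst σ P)) ss
  ⋃LSubs⊆All-𝒯-subst P single [] [] [] = []
  ⋃LSubs⊆All-𝒯-subst P single (dt ∷ dvs) (ds ∷ dss) (ls ∷ lss) =
    ⋃LSub⊆𝒯-subst P single (_ , _ , dt , ds , ls) ∷ ⋃LSubs⊆All-𝒯-subst P single dvs dss lss

rrenNs-++ : ∀ ρ B₁ B₂ → rrenNs ρ (B₁ ++ B₂) ≡ rrenNs ρ B₁ ++ rrenNs ρ B₂
rrenNs-++ ρ []       B₂ = refl
rrenNs-++ ρ (u ∷ B₁) B₂ = cong (rrenN ρ u ∷_) (rrenNs-++ ρ B₁ B₂)

⋃NApp : ℕ → Term → Term → RTerm → Set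
⋃NApp α M N s = ∃[ t ] ∃[ B ] (𝒯 M t × All (𝒯 N) B × NApp α t B s)

mutual
  𝒯-napp⊆⋃NApp : ∀ M {α N} → 𝒯 (napp α N M) ⊆ ⋃NApp α M N
  𝒯-napp⊆⋃NApp (var x) var = rvar x , [] , var , [] , var
  𝒯-napp⊆⋃NApp (lam M) {N = N} (lam d) with 𝒯-napp⊆⋃NApp M d
  ... | t , _ , dt , ds , n with All-𝒯-renV⁻ suc N ds
  ...   | B , ds′ , refl = rlam t , B , lam dt , ds′ , lam n
  𝒯-napp⊆⋃NApp (app M P) (app d ds) with 𝒯-napp⊆⋃NApp M d | All-𝒯-napp⊆⋃NApps P ds
  ... | t , B₀ , dt , ds₀ , n | vs , Bs , dvs , dss , ns =
    rapp t vs , B₀ ++ concat Bs , app dt dvs , All-weakComposition⁺ ds₀ dss , app (≈ᴮ-refl _) n ns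
  𝒯-napp⊆⋃NApp (mu γ M) {α} {N} d with γ ≟ suc α
  𝒯-napp⊆⋃NApp (mu γ M) {α} {N} d | yes refl rewrite ≡ᵇ-refl (suc α) with d
  ... | mu (app d₁ ds₂) with 𝒯-napp⊆⋃NApp M d₁
  ...   | t , _ , dt , ds₁ , n with All-𝒯-renN⁻ suc N ds₁ | All-𝒯-renN⁻ suc N ds₂
  ...     | B₁ , ds₁′ , refl | B₂ , ds₂′ , refl =
    rmu γ t , B₁ ++ B₂ , mu dt , ++⁺ ds₁′ ds₂′ ,
    mu-same (transport ((rrenNs suc B₁ ++ rrenNs suc B₂) ≈ᴮ_) (sym (rrenNs-++ suc B₁ B₂)) (≈ᴮ-refl _)) n
  𝒯-napp⊆⋃NApp (mu γ M) {α} {N} d | no γ≢α rewrite ≢⇒≡ᵇ-false γ≢α with d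
  ... | mu d′ with 𝒯-napp⊆⋃NApp M d′
  ...   | t , _ , dt , ds , n with All-𝒯-renN⁻ suc N ds
  ...     | B , ds′ , refl = rmu γ t , B , mu dt , ds′ , mu-other γ≢α n

  All-𝒯-napp⊆⋃NApps : ∀ P {α N us} → All (𝒯 (napp α N P)) us →
    ∃[ vs ] ∃[ Bs ] (All (𝒯 P) vs × All (All (𝒯 N)) Bs × NApps α vs Bs us)
  All-𝒯-napp⊆⋃NApps P [] = [] , [] , [] , [] , []
  All-𝒯-napp⊆⋃NApps P (d ∷ ds) with 𝒯-napp⊆⋃NApp P d | All-𝒯-napp⊆⋃NApps P ds
  ... | t , B , dt , dB , n | vs , Bs , dvs , dss , ns =
    t ∷ vs , B ∷ Bs , dt ∷ dvs , dB ∷ dss , n ∷ ns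

mutual
  ⋃NApp⊆𝒯-napp : ∀ M {α N} → ⋃NApp α M N ⊆ 𝒯 (napp α N M)
  ⋃NApp⊆𝒯-napp (var x) (_ , _ , var , [] , var) = var
  ⋃NApp⊆𝒯-napp (lam M) {N = N} (_ , _ , lam dt , ds , lam n) =
    lam (⋃NApp⊆𝒯-napp M (_ , _ , dt , All-𝒯-renV⁺ suc N ds , n))
  ⋃NApp⊆𝒯-napp (app M P) (_ , _ , app dt dvs , ds , app p n ns)
    with All-𝒯-weakComposition⁻ p ds
  ... | ds₀ , dss = app (⋃NApp⊆𝒯-napp M (_ , _ , dt , ds₀ , n)) (⋃NApps⊆All-𝒯-napp P dvs dss ns)
  ⋃NApp⊆𝒯-napp (mu γ M) {N = N} (_ , _ , mu dt , ds , mu-other γ≢α n) rewrite ≢⇒≡ᵇ-false γ≢α =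
    mu (⋃NApp⊆𝒯-napp M (_ , _ , dt , All-𝒯-renN⁺ suc N ds , n))
  ⋃NApp⊆𝒯-napp (mu γ M) {α} {N} (_ , _ , mu dt , ds , mu-same p n) rewrite ≡ᵇ-refl (suc α)
    with All-𝒯-++⁻ p (All-𝒯-renN⁺ suc N ds)
  ... | ds₁ , ds₂ = mu (app (⋃NApp⊆𝒯-napp M (_ , _ , dt , ds₁ , n)) ds₂)

  ⋃NApps⊆All-𝒯-napp : ∀ P {α N vs Bs ss} →
    All (𝒯 P) vs → All (All (𝒯 N)) Bs → NApps α vs Bs ss → All (𝒯 (napp α N P)) ss
  ⋃NApps⊆All-𝒯-napp P [] [] [] = []
  ⋃NApps⊆All-𝒯-napp P (dt ∷ dvs) (ds ∷ dss) (n ∷ ns) =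
    ⋃NApp⊆𝒯-napp P (_ , _ , dt , ds , n) ∷ ⋃NApps⊆All-𝒯-napp P dvs dss ns

⊆⊇⇒≐ : ∀ {S S′ : RSet} → S ⊆ S′ → S′ ⊆ S → S ≐ S′
⊆⊇⇒≐ S⊆S′ S′⊆S s = (λ { (s′ , d , e) → s′ , S⊆S′ d , e })
                 , (λ { (s′ , d , e) → s′ , S′⊆S d , e })

lemma3p3 : (M N : Term) (x α β : ℕ) →
    (𝒯 (M ⟪ α / β ⟫) ≐ (λ s → ∃[ t ] (𝒯 M t × s ≡ t ⟪ α / β ⟫ʳ)))
    × (𝒯 (M [ N / x ]) ≐ (λ s → ∃[ t ] ∃[ B ] (𝒯 M t × All (𝒯 N) B × LSub x t B s)))
    × (𝒯 (napp α N M) ≐ (λ s → ∃[ t ] ∃[ B ] (𝒯 M t × All (𝒯 N) B × NApp α t B s)))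
lemma3p3 M N x α β =
  ⊆⊇⇒≐ (𝒯-renN⁻ ρ M) (λ { (t , d , refl) → 𝒯-renN⁺ ρ M d }) ,
  ⊆⊇⇒≐ (𝒯-subst⊆⋃LSub M single) (⋃LSub⊆𝒯-subst M single) ,
  ⊆⊇⇒≐ (𝒯-napp⊆⋃NApp M) (⋃NApp⊆𝒯-napp M)
  where
  ρ : ℕ → ℕ
  ρ γ = if γ ≡ᵇ β then α else γ

  single : SingleSubst (λ y → if y ≡ᵇ x then N else var y) x N
  single = SingleSubst-[/] N x
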